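{- Let $n\geq1$ and let $e=(e_1,\ldots,e_n)\in\mathbf{I}_n(\geq,\geq,-)$ have parameters $(p,q)$. Then there are exactly $p+q$ sequences $f\in\mathbf{I}_{n+1}(\geq,\geq,-)$ whose first $n$ entries are $e$; these are exactly $f=(e_1,\ldots,e_n,b)$ with $\beta(e)<b\leq n$, and as $b$ runs from $\beta(e)+1$ to $n$ their parameters are, in order, $$(p-1,q+1),(p-2,q+1),\ldots,(0,q+1),\ (p+1,q),(p+2,q-1),\ldots,(p+q,1)$$ (the first list being empty when $p=0$).
   Context: $\mathbf{I}_n=\{(e_1,\ldots,e_n): 0\leq e_i<i\}$ is the set of inversion sequences of length $n$; $\mathbf{I}_n(\geq,\geq,-)$ is the subset of those with no indices $i<j<k$ such that $e_i\geq e_j\geq e_k$. An entry $e_i$ is a left-to-right maximum if $e_i>e_j$ for all $j<i$. For $e\in\mathbf{I}_n(\geq,\geq,-)$, let $\alpha(e)=\max\{e_1,\ldots,e_n\}$ and let $\beta(e)$ be the largest element of $\{e_i: e_i \text{ is not a left-to-right maximum}\}\cup\{ -1\}$. The parameters of $e$ are $(p,q)$ with $p=\alpha(e)-\beta(e)$ and $q=n-\alpha(e)$. -}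

module Defs where

open import Data.Nat as ℕ using (ℕ; zero; suc; _≤_; _<_; _⊔_)
import Data.Nat.Properties as ℕP
open import Data.Integer as ℤ using (ℤ; +_; -[1+_]; ∣_∣)
import Data.Integer.Properties as ℤP
open import Data.Fin as Fin using (Fin; toℕ)
import Data.Fin.Properties as FinP
open import Data.List using (List; []; _∷_; length; lookup; map; filter; allFin; upTo; foldr; _++_)
open import Data.Product using (_×_; _,_; ∃-syntax)
open import Relation.Binary.PropositionalEquality using (_≡_)
open import Relation.Nullary using (¬_; Dec; ¬?)
open import Relation.Nullary.Decidable using (_→-dec_)

-- Sequences are lists; position i (0-based, Fin) holds the entry e_{i+1}.
Seq : Set
Seq = List ℕ

-- e is an inversion sequence: 0 ≤ e_i < i (1-based), i.e. entry at 0-based i is ≤ i.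
IsInvSeq : Seq → Set
IsInvSeq e = ∀ (i : Fin (length e)) → lookup e i ≤ toℕ i

Avoids : Seq → Set
Avoids e = ¬ (∃[ i ] ∃[ j ] ∃[ k ]
  (i Fin.< j × j Fin.< k × lookup e j ≤ lookup e i × lookup e k ≤ lookup e j))

InI≥≥ : ℕ → Seq → Set
InI≥≥ n e = length e ≡ n × IsInvSeq e × Avoids e

IsLRMax : (e : Seq) → Fin (length e) → Set
IsLRMax e i = ∀ (j : Fin (length e)) → j Fin.< i → lookup e j < lookup e i

isLRMax? : (e : Seq) → (i : Fin (length e)) → Dec (IsLRMax e i)
isLRMax? e i = FinP.all? (λ j → (j Fin.<? i) →-dec (lookup e j ℕ.<? lookup e i))

α : Seq → ℕ
α e = foldr _⊔_ 0 e

β : Seq → ℤ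
β e = foldr ℤ._⊔_ (ℤ.- ℤ.1ℤ)
        (map (λ i → + lookup e i) (filter (λ i → ¬? (isLRMax? e i)) (allFin (length e))))

params : Seq → ℤ × ℤ
params e = (+ α e ℤ.- β e , + length e ℤ.- + α e)

extValues : ℕ → Seq → List ℕ
extValues n e = filter (λ b → β e ℤ.<? + b) (upTo (suc n))

expectedParams : ℤ → ℤ → List (ℤ × ℤ)
expectedParams p q =
  map (λ k → (p ℤ.- + suc k , q ℤ.+ ℤ.1ℤ)) (upTo ∣ p ∣)
  ++ map (λ j → (p ℤ.+ + suc j , q ℤ.- + j)) (upTo ∣ q ∣)

-- Appending b to e creates a pattern e_i ≥ e_j ≥ b exactly when b is at most some entry
-- e_j that is not a left-to-right maximum, i.e. when b ≤ β(e); and e·b is an inversion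
-- sequence iff b ≤ n. For b ≤ α(e) the new
-- entry is the largest non-maximal entry, so α stays and β becomes b; for b > α(e) it is a
-- new left-to-right maximum, so α becomes b and β stays. Writing s = β(e) + 1, the values
-- b = s, …, α(e) and b = α(e) + 1, …, n then produce the two announced runs of parameters.
module Submission where

open import Defs
open import Data.Nat using (ℕ; suc; _≤_)
open import Data.Integer using (ℤ; +_; _<_)
open import Data.Integer using () renaming (_+_ to _+ℤ_)
open import Data.List using (List; _∷_; []; length; map; take; _∷ʳ_)
open import Data.List.Membership.Propositional using (_∈_)
open import Data.Product using (_×_; _,_; ∃-syntax; proj₁; proj₂)
open import Function.Bundles using (_⇔_)
open import Relation.Binary.PropositionalEquality using (_≡_)

open import Data.Nat as ℕ using (zero; _+_; _∸_; _⊔_; z≤n; s≤s)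
import Data.Nat.Properties as ℕP
open import Data.Integer as ℤ using (-1ℤ; 1ℤ; -[1+_])
import Data.Integer.Properties as ℤP
open import Data.Integer.Tactic.RingSolver using (solve-∀)
open import Data.Fin as Fin using (Fin; toℕ; fromℕ<)
import Data.Fin.Properties as FinP
import Data.List as List
open import Data.List using (applyUpTo; upTo; _++_)
import Data.List.Properties as ListP
open import Data.List.Relation.Unary.Any using (here; there)
open import Data.List.Relation.Unary.All.Properties using (applyUpTo⁺₁)
open import Data.List.Membership.Propositional.Properties
  using (∈-map⁺; ∈-map⁻; ∈-filter⁺; ∈-filter⁻; ∈-allFin)
open import Data.Sum using (_⊎_; inj₁; inj₂)
open import Data.Empty using (⊥; ⊥-elim)
open import Function.Base using (_∘_)
open import Function.Bundles using (mk⇔)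
open import Relation.Nullary using (¬_; ¬?)
open import Relation.Unary using (Pred; Decidable)
open import Relation.Binary.PropositionalEquality
  using (refl; sym; trans; cong; cong₂; subst; subst₂; module ≡-Reasoning)

-- Positions as natural numbers, since Fin indices do not survive appending an entry.
-- The value 0 off the end of the list is never read.

at : Seq → ℕ → ℕ
at []       _       = 0
at (x ∷ xs) zero    = x
at (x ∷ xs) (suc k) = at xs k

lookup≡at : (xs : Seq) (i : Fin (length xs)) → List.lookup xs i ≡ at xs (toℕ i)
lookup≡at (x ∷ xs) Fin.zero    = refl
lookup≡at (x ∷ xs) (Fin.suc i) = lookup≡at xs i

lookup-fromℕ< : (xs : Seq) {k : ℕ} (k<len : k ℕ.< length xs) →
                List.lookup xs (fromℕ< k<len) ≡ at xs k
lookup-fromℕ< xs k<len = trans (lookup≡at xs _) (cong (at xs) (FinP.toℕ-fromℕ< k<len))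

length-∷ʳ : (xs : Seq) (b : ℕ) → length (xs ∷ʳ b) ≡ suc (length xs)
length-∷ʳ []       b = refl
length-∷ʳ (x ∷ xs) b = cong suc (length-∷ʳ xs b)

length<length-∷ʳ : (xs : Seq) (b : ℕ) → length xs ℕ.< length (xs ∷ʳ b)
length<length-∷ʳ xs b = ℕP.≤-reflexive (sym (length-∷ʳ xs b))

index-∷ʳ : (xs : Seq) (b : ℕ) {k : ℕ} → k ℕ.< length (xs ∷ʳ b) → k ℕ.< length xs ⊎ k ≡ length xs
index-∷ʳ xs b {k} k<len = ℕP.m<1+n⇒m<n∨m≡n (subst (k ℕ.<_) (length-∷ʳ xs b) k<len)

at-∷ʳ : (xs : Seq) (b : ℕ) {k : ℕ} → k ℕ.< length xs → at (xs ∷ʳ b) k ≡ at xs k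
at-∷ʳ (x ∷ xs) b {zero}  _           = refl
at-∷ʳ (x ∷ xs) b {suc k} (s≤s k<len) = at-∷ʳ xs b k<len

at-∷ʳ-length : (xs : Seq) (b : ℕ) → at (xs ∷ʳ b) (length xs) ≡ b
at-∷ʳ-length []       b = refl
at-∷ʳ-length (x ∷ xs) b = at-∷ʳ-length xs b

take-length-∷ʳ : (xs : Seq) (b : ℕ) → take (length xs) (xs ∷ʳ b) ≡ xs
take-length-∷ʳ []       b = refl
take-length-∷ʳ (x ∷ xs) b = cong (x ∷_) (take-length-∷ʳ xs b)

length≡suc⇒take∷ʳ : (xs : Seq) (n : ℕ) → length xs ≡ suc n → ∃[ b ] (xs ≡ take n xs ∷ʳ b)
length≡suc⇒take∷ʳ (x ∷ [])     zero    refl = x , refl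
length≡suc⇒take∷ʳ (x ∷ y ∷ ys) zero    ()
length≡suc⇒take∷ʳ (x ∷ xs)     (suc n) eq
  with b , xs≡ ← length≡suc⇒take∷ʳ xs n (ℕP.suc-injective eq) = b , cong (x ∷_) xs≡

IsInvSeqᴺ : Seq → Set
IsInvSeqᴺ e = ∀ k → k ℕ.< length e → at e k ≤ k

Avoidsᴺ : Seq → Set
Avoidsᴺ e = ∀ i j k → i ℕ.< j → j ℕ.< k → k ℕ.< length e →
            at e j ≤ at e i → at e k ≤ at e j → ⊥

IsLRMaxᴺ : Seq → ℕ → Set
IsLRMaxᴺ e k = ∀ j → j ℕ.< k → at e j ℕ.< at e k

IsInvSeq→ᴺ : ∀ e → IsInvSeq e → IsInvSeqᴺ e
IsInvSeq→ᴺ e inv k k<len =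
  subst₂ _≤_ (lookup-fromℕ< e k<len) (FinP.toℕ-fromℕ< k<len) (inv (fromℕ< k<len))

ᴺ→IsInvSeq : ∀ e → IsInvSeqᴺ e → IsInvSeq e
ᴺ→IsInvSeq e inv i = subst (_≤ toℕ i) (sym (lookup≡at e i)) (inv (toℕ i) (FinP.toℕ<n i))

Avoids→ᴺ : ∀ e → Avoids e → Avoidsᴺ e
Avoids→ᴺ e av i j k i<j j<k k<len ej≤ei ek≤ej =
  av (fromℕ< i<len , fromℕ< j<len , fromℕ< k<len ,
      subst₂ ℕ._<_ (sym (FinP.toℕ-fromℕ< i<len)) (sym (FinP.toℕ-fromℕ< j<len)) i<j ,
      subst₂ ℕ._<_ (sym (FinP.toℕ-fromℕ< j<len)) (sym (FinP.toℕ-fromℕ< k<len)) j<k ,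
      subst₂ _≤_ (sym (lookup-fromℕ< e j<len)) (sym (lookup-fromℕ< e i<len)) ej≤ei ,
      subst₂ _≤_ (sym (lookup-fromℕ< e k<len)) (sym (lookup-fromℕ< e j<len)) ek≤ej)
  where
  j<len = ℕP.<-trans j<k k<len
  i<len = ℕP.<-trans i<j j<len

ᴺ→Avoids : ∀ e → Avoidsᴺ e → Avoids e
ᴺ→Avoids e av (i , j , k , i<j , j<k , ej≤ei , ek≤ej) =
  av (toℕ i) (toℕ j) (toℕ k) i<j j<k (FinP.toℕ<n k)
     (subst₂ _≤_ (lookup≡at e j) (lookup≡at e i) ej≤ei)
     (subst₂ _≤_ (lookup≡at e k) (lookup≡at e j) ek≤ej)

IsLRMax→ᴺ : ∀ e i → IsLRMax e i → IsLRMaxᴺ e (toℕ i)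
IsLRMax→ᴺ e i lr j j<i =
  subst₂ ℕ._<_ (lookup-fromℕ< e j<len) (lookup≡at e i)
    (lr (fromℕ< j<len) (subst (ℕ._< toℕ i) (sym (FinP.toℕ-fromℕ< j<len)) j<i))
  where j<len = ℕP.<-trans j<i (FinP.toℕ<n i)

ᴺ→IsLRMax : ∀ e i → IsLRMaxᴺ e (toℕ i) → IsLRMax e i
ᴺ→IsLRMax e i lr j j<i =
  subst₂ ℕ._<_ (sym (lookup≡at e j)) (sym (lookup≡at e i)) (lr (toℕ j) j<i)

¬IsLRMaxᴺ⇒earlier≥ : ∀ e k → ¬ IsLRMaxᴺ e k → ∃[ j ] (j ℕ.< k × at e k ≤ at e j)
¬IsLRMaxᴺ⇒earlier≥ e k ¬lr = witness (FinP.¬∀⟶∃¬ k _ (λ j → _ ℕ.<? _) ¬all)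
  where
  ¬all : ¬ (∀ (j : Fin k) → at e (toℕ j) ℕ.< at e k)
  ¬all all = ¬lr λ j j<k → subst (λ t → at e t ℕ.< at e k) (FinP.toℕ-fromℕ< j<k) (all (fromℕ< j<k))
  witness : ∃[ j ] ¬ (at e (toℕ j) ℕ.< at e k) → ∃[ j ] (j ℕ.< k × at e k ≤ at e j)
  witness (j , ej≮ek) = toℕ j , FinP.toℕ<n j , ℕP.≮⇒≥ ej≮ek

IsLRMaxᴺ-∷ʳ⁺ : ∀ e b {k} → k ℕ.< length e → IsLRMaxᴺ e k → IsLRMaxᴺ (e ∷ʳ b) k
IsLRMaxᴺ-∷ʳ⁺ e b k<len lr j j<k =
  subst₂ ℕ._<_ (sym (at-∷ʳ e b (ℕP.<-trans j<k k<len))) (sym (at-∷ʳ e b k<len)) (lr j j<k)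

IsLRMaxᴺ-∷ʳ⁻ : ∀ e b {k} → k ℕ.< length e → IsLRMaxᴺ (e ∷ʳ b) k → IsLRMaxᴺ e k
IsLRMaxᴺ-∷ʳ⁻ e b k<len lr j j<k =
  subst₂ ℕ._<_ (at-∷ʳ e b (ℕP.<-trans j<k k<len)) (at-∷ʳ e b k<len) (lr j j<k)

-- The parameters α and β

at≤α : ∀ e {k} → k ℕ.< length e → at e k ≤ α e
at≤α (x ∷ xs) {zero}  _           = ℕP.m≤m⊔n x (α xs)
at≤α (x ∷ xs) {suc k} (s≤s k<len) = ℕP.≤-trans (at≤α xs k<len) (ℕP.m≤n⊔m x (α xs))

α-attained : ∀ e → 0 ℕ.< length e → ∃[ k ] (k ℕ.< length e × at e k ≡ α e)
α-attained (x ∷ [])     _ = 0 , s≤s z≤n , sym (ℕP.⊔-identityʳ x)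
α-attained (x ∷ y ∷ ys) _ = combine (ℕP.⊔-sel x (α (y ∷ ys))) (α-attained (y ∷ ys) (s≤s z≤n))
  where
  combine : α (x ∷ y ∷ ys) ≡ x ⊎ α (x ∷ y ∷ ys) ≡ α (y ∷ ys) →
            ∃[ k ] (k ℕ.< length (y ∷ ys) × at (y ∷ ys) k ≡ α (y ∷ ys)) →
            ∃[ k ] (k ℕ.< length (x ∷ y ∷ ys) × at (x ∷ y ∷ ys) k ≡ α (x ∷ y ∷ ys))
  combine (inj₁ α≡x)  _                       = 0 , s≤s z≤n , sym α≡x
  combine (inj₂ α≡α′) (k , k<len , ek≡α′) = suc k , s≤s k<len , trans ek≡α′ (sym α≡α′)

α-∷ʳ : ∀ e b → α (e ∷ʳ b) ≡ α e ⊔ b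
α-∷ʳ []       b = ℕP.⊔-identityʳ b
α-∷ʳ (x ∷ xs) b = trans (cong (x ⊔_) (α-∷ʳ xs b)) (sym (ℕP.⊔-assoc x (α xs) b))

α<length : ∀ e → IsInvSeqᴺ e → 0 ℕ.< length e → α e ℕ.< length e
α<length e inv 0<len with k , k<len , ek≡α ← α-attained e 0<len =
  subst (ℕ._< length e) ek≡α (ℕP.≤-<-trans (inv k k<len) k<len)

module _ (z : ℤ) where

  z≤foldr-⊔ : ∀ xs → z ℤ.≤ List.foldr ℤ._⊔_ z xs
  z≤foldr-⊔ []       = ℤP.≤-refl
  z≤foldr-⊔ (y ∷ ys) = ℤP.≤-trans (z≤foldr-⊔ ys) (ℤP.i≤j⊔i y _)

  ∈⇒≤foldr-⊔ : ∀ {x} xs → x ∈ xs → x ℤ.≤ List.foldr ℤ._⊔_ z xs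
  ∈⇒≤foldr-⊔ (y ∷ ys) (here refl) = ℤP.i≤i⊔j y _
  ∈⇒≤foldr-⊔ (y ∷ ys) (there x∈) = ℤP.≤-trans (∈⇒≤foldr-⊔ ys x∈) (ℤP.i≤j⊔i y _)

  foldr-⊔-attained : ∀ xs → List.foldr ℤ._⊔_ z xs ≡ z ⊎ List.foldr ℤ._⊔_ z xs ∈ xs
  foldr-⊔-attained []       = inj₁ refl
  foldr-⊔-attained (y ∷ ys) with ℤP.⊔-sel y (List.foldr ℤ._⊔_ z ys)
  ... | inj₁ ≡y = inj₂ (here ≡y)
  ... | inj₂ ≡rest with foldr-⊔-attained ys
  ...   | inj₁ ≡z  = inj₁ (trans ≡rest ≡z)
  ...   | inj₂ ∈ys = inj₂ (there (subst (_∈ ys) (sym ≡rest) ∈ys))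

  foldr-⊔-least : ∀ {m} xs → z ℤ.≤ m → (∀ {x} → x ∈ xs → x ℤ.≤ m) → List.foldr ℤ._⊔_ z xs ℤ.≤ m
  foldr-⊔-least []       z≤m ub = z≤m
  foldr-⊔-least (y ∷ ys) z≤m ub =
    ℤP.⊔-lub (ub (here refl)) (foldr-⊔-least ys z≤m (λ x∈ → ub (there x∈)))

  foldr-⊔-unique : ∀ {m} xs → z ℤ.≤ m → (∀ {x} → x ∈ xs → x ℤ.≤ m) → m ≡ z ⊎ m ∈ xs →
                   m ≡ List.foldr ℤ._⊔_ z xs
  foldr-⊔-unique xs z≤m ub (inj₁ refl) = ℤP.≤-antisym (z≤foldr-⊔ xs) (foldr-⊔-least xs z≤m ub)
  foldr-⊔-unique xs z≤m ub (inj₂ m∈)   = ℤP.≤-antisym (∈⇒≤foldr-⊔ xs m∈) (foldr-⊔-least xs z≤m ub)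

nonMaxEntries : Seq → List ℤ
nonMaxEntries e =
  map (λ i → + List.lookup e i) (List.filter (λ i → ¬? (isLRMax? e i)) (List.allFin (length e)))

NonMaxEntry : Seq → ℤ → Set
NonMaxEntry e m = ∃[ k ] (k ℕ.< length e × ¬ IsLRMaxᴺ e k × m ≡ + at e k)

∈nonMaxEntries⇒ : ∀ e {x} → x ∈ nonMaxEntries e → NonMaxEntry e x
∈nonMaxEntries⇒ e x∈ with i , i∈ , x≡ ← ∈-map⁻ (λ i → + List.lookup e i) x∈
  with _ , ¬lr ← ∈-filter⁻ (λ i → ¬? (isLRMax? e i)) {xs = List.allFin (length e)} i∈
  = toℕ i , FinP.toℕ<n i , (λ lr → ¬lr (ᴺ→IsLRMax e i lr)) , trans x≡ (cong +_ (lookup≡at e i))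

NonMaxEntry⇒∈ : ∀ e {x} → NonMaxEntry e x → x ∈ nonMaxEntries e
NonMaxEntry⇒∈ e (k , k<len , ¬lr , refl) =
  subst (_∈ nonMaxEntries e) (cong +_ (lookup-fromℕ< e k<len))
    (∈-map⁺ (λ i → + List.lookup e i)
      (∈-filter⁺ (λ i → ¬? (isLRMax? e i)) (∈-allFin (fromℕ< k<len)) ¬lr′))
  where
  ¬lr′ : ¬ IsLRMax e (fromℕ< k<len)
  ¬lr′ lr = ¬lr (subst (IsLRMaxᴺ e) (FinP.toℕ-fromℕ< k<len) (IsLRMax→ᴺ e _ lr))

-1≤β : ∀ e → -1ℤ ℤ.≤ β e
-1≤β e = z≤foldr-⊔ -1ℤ (nonMaxEntries e)

nonMax≤β : ∀ e {k} → k ℕ.< length e → ¬ IsLRMaxᴺ e k → + at e k ℤ.≤ β e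
nonMax≤β e k<len ¬lr = ∈⇒≤foldr-⊔ -1ℤ (nonMaxEntries e) (NonMaxEntry⇒∈ e (_ , k<len , ¬lr , refl))

β-attained : ∀ e → β e ≡ -1ℤ ⊎ NonMaxEntry e (β e)
β-attained e with foldr-⊔-attained -1ℤ (nonMaxEntries e)
... | inj₁ β≡-1 = inj₁ β≡-1
... | inj₂ β∈   = inj₂ (∈nonMaxEntries⇒ e β∈)

β-unique : ∀ e {m} → -1ℤ ℤ.≤ m →
           (∀ {k} → k ℕ.< length e → ¬ IsLRMaxᴺ e k → + at e k ℤ.≤ m) →
           m ≡ -1ℤ ⊎ NonMaxEntry e m → m ≡ β e
β-unique e -1≤m nonMax≤m attained = foldr-⊔-unique -1ℤ (nonMaxEntries e) -1≤m ub (∈-form attained)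
  where
  ub : ∀ {x} → x ∈ nonMaxEntries e → x ℤ.≤ _
  ub x∈ with k , k<len , ¬lr , refl ← ∈nonMaxEntries⇒ e x∈ = nonMax≤m k<len ¬lr
  ∈-form : _ ≡ -1ℤ ⊎ NonMaxEntry e _ → _ ≡ -1ℤ ⊎ _ ∈ nonMaxEntries e
  ∈-form (inj₁ m≡-1)    = inj₁ m≡-1
  ∈-form (inj₂ nonMax) = inj₂ (NonMaxEntry⇒∈ e nonMax)

β-∷ʳ-≤α : ∀ e b → 0 ℕ.< length e → β e < + b → b ≤ α e → β (e ∷ʳ b) ≡ + b
β-∷ʳ-≤α e b 0<len β<b b≤α =
  sym (β-unique (e ∷ʳ b) ℤ.-≤+ ub
        (inj₂ (length e , length<length-∷ʳ e b , ¬lr , sym (cong +_ (at-∷ʳ-length e b)))))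
  where
  ub : ∀ {k} → k ℕ.< length (e ∷ʳ b) → ¬ IsLRMaxᴺ (e ∷ʳ b) k → + at (e ∷ʳ b) k ℤ.≤ + b
  ub k<len ¬lr with index-∷ʳ e b k<len
  ... | inj₁ k<e = subst (λ x → + x ℤ.≤ + b) (sym (at-∷ʳ e b k<e))
    (ℤP.<⇒≤ (ℤP.≤-<-trans (nonMax≤β e k<e (λ lr → ¬lr (IsLRMaxᴺ-∷ʳ⁺ e b k<e lr))) β<b))
  ... | inj₂ refl = ℤP.≤-reflexive (cong +_ (at-∷ʳ-length e b))
  ¬lr : ¬ IsLRMaxᴺ (e ∷ʳ b) (length e)
  ¬lr lr with j , j<len , ej≡α ← α-attained e 0<len =
    ℕP.<⇒≱ (subst₂ ℕ._<_ (at-∷ʳ e b j<len) (at-∷ʳ-length e b) (lr j j<len))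
           (subst (b ≤_) (sym ej≡α) b≤α)

β-∷ʳ->α : ∀ e b → α e ℕ.< b → β (e ∷ʳ b) ≡ β e
β-∷ʳ->α e b α<b = sym (β-unique (e ∷ʳ b) (-1≤β e) ub (attained (β-attained e)))
  where
  ub : ∀ {k} → k ℕ.< length (e ∷ʳ b) → ¬ IsLRMaxᴺ (e ∷ʳ b) k → + at (e ∷ʳ b) k ℤ.≤ β e
  ub k<len ¬lr with index-∷ʳ e b k<len
  ... | inj₁ k<e = subst (λ x → + x ℤ.≤ β e) (sym (at-∷ʳ e b k<e))
    (nonMax≤β e k<e (λ lr → ¬lr (IsLRMaxᴺ-∷ʳ⁺ e b k<e lr)))
  ... | inj₂ refl = ⊥-elim (¬lr λ j j<len →
    subst₂ ℕ._<_ (sym (at-∷ʳ e b j<len)) (sym (at-∷ʳ-length e b)) (ℕP.≤-<-trans (at≤α e j<len) α<b))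
  attained : β e ≡ -1ℤ ⊎ NonMaxEntry e (β e) → β e ≡ -1ℤ ⊎ NonMaxEntry (e ∷ʳ b) (β e)
  attained (inj₁ β≡-1)                      = inj₁ β≡-1
  attained (inj₂ (k , k<len , ¬lr , β≡ek)) =
    inj₂ (k , ℕP.<-trans k<len (length<length-∷ʳ e b) , (λ lr → ¬lr (IsLRMaxᴺ-∷ʳ⁻ e b k<len lr)) ,
          trans β≡ek (cong +_ (sym (at-∷ʳ e b k<len))))

-- One-entry extensions

extension-bounds : ∀ e b → IsInvSeq (e ∷ʳ b) → Avoids (e ∷ʳ b) → β e < + b × b ≤ length e
extension-bounds e b inv av = ℤP.≰⇒> b≰β , b≤n
  where
  n<len = length<length-∷ʳ e b
  b≤n : b ≤ length e
  b≤n = subst (_≤ length e) (at-∷ʳ-length e b) (IsInvSeq→ᴺ (e ∷ʳ b) inv (length e) n<len)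
  b≰β : ¬ (+ b ℤ.≤ β e)
  b≰β b≤β with β-attained e
  ... | inj₁ β≡-1 with () ← subst (+ b ℤ.≤_) β≡-1 b≤β
  b≰β b≤β | inj₂ (k , k<len , ¬lr , β≡ek) with j , j<k , ek≤ej ← ¬IsLRMaxᴺ⇒earlier≥ e k ¬lr =
    Avoids→ᴺ (e ∷ʳ b) av j k (length e) j<k k<len n<len
      (subst₂ _≤_ (sym (at-∷ʳ e b k<len)) (sym (at-∷ʳ e b (ℕP.<-trans j<k k<len))) ek≤ej)
      (subst₂ _≤_ (sym (at-∷ʳ-length e b)) (sym (at-∷ʳ e b k<len))
        (ℤP.drop‿+≤+ (subst (+ b ℤ.≤_) β≡ek b≤β)))

extension-valid : ∀ e b → IsInvSeq e → Avoids e → β e < + b → b ≤ length e →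
                  InI≥≥ (suc (length e)) (e ∷ʳ b)
extension-valid e b inv av β<b b≤n =
  length-∷ʳ e b , ᴺ→IsInvSeq (e ∷ʳ b) inv′ , ᴺ→Avoids (e ∷ʳ b) av′
  where
  inv′ : IsInvSeqᴺ (e ∷ʳ b)
  inv′ k k<len with index-∷ʳ e b k<len
  ... | inj₁ k<e  = subst (_≤ k) (sym (at-∷ʳ e b k<e)) (IsInvSeq→ᴺ e inv k k<e)
  ... | inj₂ refl = subst (_≤ length e) (sym (at-∷ʳ-length e b)) b≤n
  av′ : Avoidsᴺ (e ∷ʳ b)
  av′ i j k i<j j<k k<len ej≤ei ek≤ej with index-∷ʳ e b k<len
  ... | inj₁ k<e =
    Avoids→ᴺ e av i j k i<j j<k k<e
      (subst₂ _≤_ (at-∷ʳ e b j<e) (at-∷ʳ e b i<e) ej≤ei)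
      (subst₂ _≤_ (at-∷ʳ e b k<e) (at-∷ʳ e b j<e) ek≤ej)
    where
    j<e = ℕP.<-trans j<k k<e
    i<e = ℕP.<-trans i<j j<e
  ... | inj₂ refl = ℕP.<⇒≱ (ℤP.drop‿+<+ (ℤP.≤-<-trans (nonMax≤β e j<k ¬lr) β<b)) b≤ej
    where
    i<e = ℕP.<-trans i<j j<k
    ¬lr : ¬ IsLRMaxᴺ e j
    ¬lr lr = ℕP.<⇒≱ (lr i i<j) (subst₂ _≤_ (at-∷ʳ e b j<k) (at-∷ʳ e b i<e) ej≤ei)
    b≤ej : b ≤ at e j
    b≤ej = subst₂ _≤_ (at-∷ʳ-length e b) (at-∷ʳ e b j<k) ek≤ej

extensions : ∀ e → IsInvSeq e → Avoids e → (f : List ℕ) →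
             (InI≥≥ (suc (length e)) f × take (length e) f ≡ e)
             ⇔ (∃[ b ] (f ≡ e ∷ʳ b × β e < + b × b ≤ length e))
extensions e inv av f = mk⇔ to from
  where
  to : InI≥≥ (suc (length e)) f × take (length e) f ≡ e →
       ∃[ b ] (f ≡ e ∷ʳ b × β e < + b × b ≤ length e)
  to ((len≡ , invf , avf) , take≡e) with b , f≡ ← length≡suc⇒take∷ʳ f (length e) len≡ =
    b , f≡e∷ʳb , extension-bounds e b (subst IsInvSeq f≡e∷ʳb invf) (subst Avoids f≡e∷ʳb avf)
    where
    f≡e∷ʳb = trans f≡ (cong (_∷ʳ b) take≡e)
  from : ∃[ b ] (f ≡ e ∷ʳ b × β e < + b × b ≤ length e) →
         InI≥≥ (suc (length e)) f × take (length e) f ≡ e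
  from (b , refl , β<b , b≤n) = extension-valid e b inv av β<b b≤n , take-length-∷ʳ e b

params-∷ʳ-≤α : ∀ e b → 0 ℕ.< length e → β e < + b → b ≤ α e →
               params (e ∷ʳ b) ≡ (+ α e ℤ.- + b , + suc (length e) ℤ.- + α e)
params-∷ʳ-≤α e b 0<len β<b b≤α =
  cong₂ _,_ (cong₂ (λ a c → + a ℤ.- c) α≡ (β-∷ʳ-≤α e b 0<len β<b b≤α))
            (cong₂ (λ l a → + l ℤ.- + a) (length-∷ʳ e b) α≡)
  where α≡ = trans (α-∷ʳ e b) (ℕP.m≥n⇒m⊔n≡m b≤α)

params-∷ʳ->α : ∀ e b → α e ℕ.< b → params (e ∷ʳ b) ≡ (+ b ℤ.- β e , + suc (length e) ℤ.- + b)
params-∷ʳ->α e b α<b =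
  cong₂ _,_ (cong₂ (λ a c → + a ℤ.- c) α≡ (β-∷ʳ->α e b α<b))
            (cong₂ (λ l a → + l ℤ.- + a) (length-∷ʳ e b) α≡)
  where α≡ = trans (α-∷ʳ e b) (ℕP.m≤n⇒m⊔n≡n (ℕP.<⇒≤ α<b))

-- Enumerating the extensions

applyUpTo-++ : ∀ {A : Set} (f : ℕ → A) m k →
               applyUpTo f (m + k) ≡ applyUpTo f m ++ applyUpTo (λ i → f (m + i)) k
applyUpTo-++ f zero    k = refl
applyUpTo-++ f (suc m) k = cong (f 0 ∷_) (applyUpTo-++ (λ i → f (suc i)) m k)

applyUpTo-cong : ∀ {A : Set} {f g : ℕ → A} n → (∀ {i} → i ℕ.< n → f i ≡ g i) →
                 applyUpTo f n ≡ applyUpTo g n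
applyUpTo-cong zero    f≡g = refl
applyUpTo-cong (suc n) f≡g = cong₂ _∷_ (f≡g (s≤s z≤n)) (applyUpTo-cong n (λ i<n → f≡g (s≤s i<n)))

filter-upTo-threshold : ∀ {p} {P : Pred ℕ p} (P? : Decidable P) {s m} →
                        (∀ {b} → b ℕ.< s → ¬ P b) → (∀ {b} → s ≤ b → P b) → s ≤ m →
                        List.filter P? (upTo m) ≡ applyUpTo (λ i → s + i) (m ∸ s)
filter-upTo-threshold P? {s} {m} below above s≤m = begin
  List.filter P? (upTo m)
    ≡⟨ cong (List.filter P? ∘ upTo) (sym (ℕP.m+[n∸m]≡n s≤m)) ⟩
  List.filter P? (upTo (s + (m ∸ s)))
    ≡⟨ cong (List.filter P?) (applyUpTo-++ (λ i → i) s (m ∸ s)) ⟩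
  List.filter P? (upTo s ++ applyUpTo (λ i → s + i) (m ∸ s))
    ≡⟨ ListP.filter-++ P? (upTo s) _ ⟩
  List.filter P? (upTo s) ++ List.filter P? (applyUpTo (λ i → s + i) (m ∸ s))
    ≡⟨ cong₂ _++_ (ListP.filter-none P? (applyUpTo⁺₁ _ s below))
                  (ListP.filter-all P? (applyUpTo⁺₁ _ (m ∸ s) (λ _ → above (ℕP.m≤m+n s _)))) ⟩
  applyUpTo (λ i → s + i) (m ∸ s)
    ∎
  where open ≡-Reasoning

-1≤⇒pred : ∀ {c} → -1ℤ ℤ.≤ c → ∃[ s ] (c ≡ + s ℤ.- 1ℤ)
-1≤⇒pred {+ x}            _           = suc x , refl
-1≤⇒pred { -[1+ zero ]}  _           = 0 , refl
-1≤⇒pred { -[1+ suc _ ]} (ℤ.-≤- ())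

pred<+⇒≤ : ∀ {s b} → + s ℤ.- 1ℤ < + b → s ≤ b
pred<+⇒≤ {zero}  _             = z≤n
pred<+⇒≤ {suc s} (ℤ.+<+ s<b) = s<b

≤⇒pred<+ : ∀ {s b} → s ≤ b → + s ℤ.- 1ℤ < + b
≤⇒pred<+ {zero}  _   = ℤ.-<+
≤⇒pred<+ {suc s} s<b = ℤ.+<+ s<b

pos-∸ : ∀ {m n} → n ≤ m → + (m ∸ n) ≡ + m ℤ.- + n
pos-∸ {m} {n} n≤m = sym (trans (ℤP.m-n≡m⊖n m n) (ℤP.⊖-≥ n≤m))

module _ (e : Seq) (0<len : 0 ℕ.< length e) (inv : IsInvSeqᴺ e) where

  private
    n = length e

    s : ℕ
    s = proj₁ (-1≤⇒pred (-1≤β e))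

    β≡s-1 : β e ≡ + s ℤ.- 1ℤ
    β≡s-1 = proj₂ (-1≤⇒pred (-1≤β e))

    s≤1+α : s ≤ suc (α e)
    s≤1+α = pred<+⇒≤ (subst (_< + suc (α e)) β≡s-1 β<1+α)
      where
      β<1+α : β e < + suc (α e)
      β<1+α with β-attained e
      ... | inj₁ β≡-1                  = subst (_< + suc (α e)) (sym β≡-1) ℤ.-<+
      ... | inj₂ (k , k<len , _ , β≡ek) = subst (_< + suc (α e)) (sym β≡ek) (ℤ.+<+ (s≤s (at≤α e k<len)))

    α≤n : α e ≤ n
    α≤n = ℕP.<⇒≤ (α<length e inv 0<len)

    d₁ d₂ : ℕ
    d₁ = suc (α e) ∸ s
    d₂ = n ∸ α e

    p≡d₁ : + α e ℤ.- β e ≡ + d₁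
    p≡d₁ = begin
      + α e ℤ.- β e                  ≡⟨ cong (λ x → + α e ℤ.- x) β≡s-1 ⟩
      + α e ℤ.- (+ s ℤ.- 1ℤ)         ≡⟨ minus-pred (+ α e) (+ s) ⟩
      (1ℤ ℤ.+ + α e) ℤ.- + s         ≡⟨ sym (pos-∸ s≤1+α) ⟩
      + d₁                           ∎
      where
      open ≡-Reasoning
      minus-pred : ∀ a c → a ℤ.- (c ℤ.- 1ℤ) ≡ (1ℤ ℤ.+ a) ℤ.- c
      minus-pred = solve-∀

    q≡d₂ : + n ℤ.- + α e ≡ + d₂
    q≡d₂ = sym (pos-∸ α≤n)

    extValues≡ : extValues n e ≡ applyUpTo (λ i → s + i) (d₁ + d₂)
    extValues≡ = trans
      (filter-upTo-threshold (λ b → β e ℤ.<? + b)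
        (λ b<s β<b → ℕP.<⇒≱ b<s (pred<+⇒≤ (subst (_< _) β≡s-1 β<b)))
        (λ s≤b → subst (_< _) (sym β≡s-1) (≤⇒pred<+ s≤b))
        (ℕP.≤-trans s≤1+α (s≤s α≤n)))
      (cong (applyUpTo (λ i → s + i)) 1+n∸s≡)
      where
      1+n∸s≡ : suc n ∸ s ≡ d₁ + d₂
      1+n∸s≡ = trans (cong (λ m → suc m ∸ s) (sym (ℕP.m+[n∸m]≡n α≤n)))
                     (ℕP.+-∸-comm d₂ s≤1+α)

    params-lower : ∀ {k} → k ℕ.< d₁ → params (e ∷ʳ (s + k)) ≡ (+ d₁ ℤ.- + suc k , + d₂ ℤ.+ 1ℤ)
    params-lower {k} k<d₁ = trans (params-∷ʳ-≤α e (s + k) 0<len β<b b≤α)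
      (cong₂ _,_ (trans (shift (+ α e) (+ s) (+ k)) (cong (ℤ._- + suc k) (sym (pos-∸ s≤1+α))))
                 (trans (grow (+ n) (+ α e)) (cong (ℤ._+ 1ℤ) q≡d₂)))
      where
      β<b : β e < + (s + k)
      β<b = subst (_< + (s + k)) (sym β≡s-1) (≤⇒pred<+ (ℕP.m≤m+n s k))
      b≤α : s + k ≤ α e
      b≤α = ℕP.≤-pred (subst (s + k ℕ.<_) (ℕP.m+[n∸m]≡n s≤1+α) (ℕP.+-monoʳ-< s k<d₁))
      shift : ∀ a c k → a ℤ.- (c ℤ.+ k) ≡ ((1ℤ ℤ.+ a) ℤ.- c) ℤ.- (1ℤ ℤ.+ k)
      shift = solve-∀
      grow : ∀ l a → (1ℤ ℤ.+ l) ℤ.- a ≡ (l ℤ.- a) ℤ.+ 1ℤ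
      grow = solve-∀

    params-upper : ∀ {k} → k ℕ.< d₂ → params (e ∷ʳ (s + (d₁ + k))) ≡ (+ d₁ ℤ.+ + suc k , + d₂ ℤ.- + k)
    params-upper {k} _ = trans (params-∷ʳ->α e (s + (d₁ + k)) α<b)
      (cong₂ _,_ (trans (cong (λ x → + (s + (d₁ + k)) ℤ.- x) β≡s-1) (cancel (+ s) (+ d₁) (+ k)))
                 (trans (cong (λ b → + suc n ℤ.- + b) b≡) (trans (shrink (+ n) (+ α e) (+ k))
                   (cong (ℤ._- + k) q≡d₂))))
      where
      b≡ : s + (d₁ + k) ≡ suc (α e + k)
      b≡ = trans (sym (ℕP.+-assoc s d₁ k)) (cong (_+ k) (ℕP.m+[n∸m]≡n s≤1+α))
      α<b : α e ℕ.< s + (d₁ + k)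
      α<b = subst (α e ℕ.<_) (sym b≡) (s≤s (ℕP.m≤m+n (α e) k))
      cancel : ∀ c d k → (c ℤ.+ (d ℤ.+ k)) ℤ.- (c ℤ.- 1ℤ) ≡ d ℤ.+ (1ℤ ℤ.+ k)
      cancel = solve-∀
      shrink : ∀ l a k → (1ℤ ℤ.+ l) ℤ.- (1ℤ ℤ.+ (a ℤ.+ k)) ≡ (l ℤ.- a) ℤ.- k
      shrink = solve-∀

  extValues-length : + length (extValues n e) ≡ proj₁ (params e) +ℤ proj₂ (params e)
  extValues-length = begin
    + length (extValues n e)                       ≡⟨ cong (+_ ∘ length) extValues≡ ⟩
    + length (applyUpTo (λ i → s + i) (d₁ + d₂))   ≡⟨ cong +_ (ListP.length-applyUpTo _ (d₁ + d₂)) ⟩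
    + d₁ +ℤ + d₂                                   ≡⟨ cong₂ _+ℤ_ (sym p≡d₁) (sym q≡d₂) ⟩
    proj₁ (params e) +ℤ proj₂ (params e)           ∎
    where open ≡-Reasoning

  extValues-params : map (λ b → params (e ∷ʳ b)) (extValues n e)
                     ≡ expectedParams (proj₁ (params e)) (proj₂ (params e))
  extValues-params = begin
    map F (extValues n e)                          ≡⟨ cong (map F) extValues≡ ⟩
    map F (applyUpTo (λ i → s + i) (d₁ + d₂))      ≡⟨ ListP.map-applyUpTo _ F (d₁ + d₂) ⟩
    applyUpTo (λ i → F (s + i)) (d₁ + d₂)          ≡⟨ applyUpTo-++ _ d₁ d₂ ⟩
    applyUpTo (λ i → F (s + i)) d₁ ++ applyUpTo (λ i → F (s + (d₁ + i))) d₂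
      ≡⟨ cong₂ _++_ (applyUpTo-cong d₁ params-lower) (applyUpTo-cong d₂ params-upper) ⟩
    applyUpTo lower d₁ ++ applyUpTo upper d₂
      ≡⟨ sym (cong₂ _++_ (ListP.map-upTo lower d₁) (ListP.map-upTo upper d₂)) ⟩
    expectedParams (+ d₁) (+ d₂)                    ≡⟨ cong₂ expectedParams (sym p≡d₁) (sym q≡d₂) ⟩
    expectedParams (proj₁ (params e)) (proj₂ (params e)) ∎
    where
    open ≡-Reasoning
    F : ℕ → ℤ × ℤ
    F b = params (e ∷ʳ b)
    lower upper : ℕ → ℤ × ℤ
    lower k = (+ d₁ ℤ.- + suc k , + d₂ ℤ.+ 1ℤ)
    upper k = (+ d₁ ℤ.+ + suc k , + d₂ ℤ.- + k)

lemma2p2 : (n : ℕ) → 1 ≤ n → (e : List ℕ) → InI≥≥ n e →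
    ((f : List ℕ) → (InI≥≥ (suc n) f × take n f ≡ e)
                     ⇔ (∃[ b ] (f ≡ e ∷ʳ b × β e < + b × b ≤ n)))
    × + length (extValues n e) ≡ proj₁ (params e) +ℤ proj₂ (params e)
    × map (λ b → params (e ∷ʳ b)) (extValues n e)
        ≡ expectedParams (proj₁ (params e)) (proj₂ (params e))
lemma2p2 .(length e) 1≤n e (refl , inv , av) =
  extensions e inv av ,
  extValues-length e 1≤n (IsInvSeq→ᴺ e inv) ,
  extValues-params e 1≤n (IsInvSeq→ᴺ e inv)
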